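{- Let $n\ge1$ and $k\ge1$ be integers. Then the number of set-valued tableaux of one-row shape $(k)$ with entries in $[n]$ is $$|\mathrm{SVT}((k),n)|=\binom{n+k-1}{k}\,{}_2F_1\!\left(k,\,1-n;\,k+1;\,-1\right).$$
   Context: A set-valued tableau of shape $\lambda$ with entries in $[n]=\{1,\dots,n\}$ assigns to each box $(i,j)$ of the Young diagram of $\lambda$ a non-empty subset $T_{i,j}\subseteq[n]$ such that $\max T_{i,j}\le \min T_{i,j+1}$ and $\max T_{i,j}<\min T_{i+1,j}$ whenever these boxes exist; $\mathrm{SVT}(\lambda,n)$ denotes the set of such tableaux. The Gauss hypergeometric series is ${}_2F_1(a,b;c;z)=\sum_{m\ge0}\frac{(a)_m(b)_m}{(c)_m}\frac{z^m}{m!}$ with $(a)_m=a(a+1)\cdots(a+m-1)$, $(a)_0=1$; here it is a terminating (finite) sum. -}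

module Defs where

open import Data.Bool using (Bool; true; false; _∧_; not)
open import Data.Nat as ℕ using (ℕ; zero; suc; _⊔_; _⊓_; _≤ᵇ_; _<ᵇ_)
open import Data.List as List using (List; []; _∷_; map; foldr; concatMap; length; filterᵇ; zipWith; applyUpTo)
open import Data.Bool.ListAction using (and)
open import Data.Vec as Vec using (Vec; []; _∷_)
open import Data.Fin.Subset using (Subset; Side; inside; outside)
open import Data.Integer as ℤ using (ℤ)
open import Data.Rational as ℚ using (ℚ; 0ℚ; 1ℚ; _+_; _*_; _÷_; _≟_; -_)
open import Relation.Nullary using (yes; no)

-- Subsets of [n] = {1,…,n}.  A subset is 'Subset n' (Vec Side n);
-- position i (a Fin n) stands for the number i+1 ∈ [n].

elems : ∀ {n} → Subset n → List ℕ
elems []            = []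
elems (inside  ∷ p) = 1 ∷ map suc (elems p)
elems (outside ∷ p) = map suc (elems p)

nonemptyᵇ : ∀ {n} → Subset n → Bool
nonemptyᵇ p with elems p
... | []    = false
... | _ ∷ _ = true

-- max and min of a subset of [n] (only used on non-empty subsets,
-- where they are the usual max / min)
maxS : ∀ {n} → Subset n → ℕ
maxS p = foldr _⊔_ 0 (elems p)

minS : ∀ {n} → Subset n → ℕ
minS {n} p = foldr _⊓_ (suc n) (elems p)

allSubsets : (n : ℕ) → List (Subset n)
allSubsets zero    = [] ∷ []
allSubsets (suc n) = concatMap (λ p → (outside ∷ p) ∷ (inside ∷ p) ∷ []) (allSubsets n)

-- A shape λ = (λ₁, λ₂, …) is given as the list of its row lengths.
-- A filling of λ assigns a subset of [n] to every box; it is stored as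
-- the list of its rows (row i is a list of λᵢ subsets).

listsOfLength : ∀ {A : Set} → List A → ℕ → List (List A)
listsOfLength xs zero    = [] ∷ []
listsOfLength xs (suc r) = concatMap (λ x → map (x ∷_) (listsOfLength xs r)) xs

fillings : (λ′ : List ℕ) (n : ℕ) → List (List (List (Subset n)))
fillings []        n = [] ∷ []
fillings (r ∷ λ′)  n =
  concatMap (λ row → map (row ∷_) (fillings λ′ n)) (listsOfLength (allSubsets n) r)

allNonempty : ∀ {n} → List (List (Subset n)) → Bool
allNonempty rows = and (map (λ row → and (map nonemptyᵇ row)) rows)

rowWeak : ∀ {n} → List (Subset n) → Bool
rowWeak []           = true
rowWeak (a ∷ [])     = true
rowWeak (a ∷ b ∷ bs) = (maxS a ≤ᵇ minS b) ∧ rowWeak (b ∷ bs)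

colStrict : ∀ {n} → List (List (Subset n)) → Bool
colStrict []              = true
colStrict (r ∷ [])        = true
colStrict (r ∷ r′ ∷ rs)   =
  and (zipWith (λ a b → maxS a <ᵇ minS b) r r′) ∧ colStrict (r′ ∷ rs)

isSVT : ∀ {n} → List (List (Subset n)) → Bool
isSVT rows = allNonempty rows ∧ and (map rowWeak rows) ∧ colStrict rows

SVT : (λ′ : List ℕ) (n : ℕ) → List (List (List (Subset n)))
SVT λ′ n = filterᵇ isSVT (fillings λ′ n)

numSVT : List ℕ → ℕ → ℕ
numSVT λ′ n = length (SVT λ′ n)

-- total division: the usual quotient when q ≠ 0 (the only case used)
_/ℚ_ : ℚ → ℚ → ℚ
p /ℚ q with q ≟ 0ℚ
... | yes _  = 0ℚ
... | no q≢0 = _÷_ p q {{ℚ.≢-nonZero q≢0}}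

poch : ℚ → ℕ → ℚ
poch a zero    = 1ℚ
poch a (suc m) = poch a m * (a + (ℤ.+ m ℚ./ 1))

_^ℚ_ : ℚ → ℕ → ℚ
z ^ℚ zero  = 1ℚ
z ^ℚ suc m = (z ^ℚ m) * z

natℚ : ℕ → ℚ
natℚ m = ℤ.+ m ℚ./ 1

sumℚ : List ℚ → ℚ
sumℚ = foldr _+_ 0ℚ

-- Terminating Gauss series 2F1(a, -N; c; z) = Σ_{m=0}^{N} (a)_m (-N)_m/(c)_m z^m/m!
-- (for b = -N a non-positive integer all terms with m > N vanish).
-- Here it is written with the upper parameter b given and summed up to N.
F21 : (a b c z : ℚ) (N : ℕ) → ℚ
F21 a b c z N =
  sumℚ (applyUpTo (λ m → ((poch a m * poch b m) /ℚ poch c m) * ((z ^ℚ m) /ℚ natℚ (m ℕ.!))) (suc N))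

{-# OPTIONS --safe #-}
-- Reading a row box by box and splitting on whether the entry 1 occurs, the number A(n, k) of
-- one-row tableaux with k boxes and entries in [n] satisfies A(n+1, k+1) = A(n+1, k) + 2 A(n, k+1).
-- Pascal's rule shows that Σ_i C(n+k, i+1) C(i, k) satisfies the same recurrence, so
-- A(n, k+1) = Σ_{m<n} C(n+k, k+1+m) C(k+m, k). By absorption and trinomial revision the m-th summand
-- is C(n+k, k+1) (k+1)_m (1-n)_m (-1)^m / ((k+2)_m m!), i.e. C(n+k, k+1) times the m-th Gauss term.
module Submission where

open import Defs

module OneRowTableaux where
  open import Data.Bool using (Bool; true; false; _∧_; if_then_else_)
  open import Data.Bool.ListAction using (and)
  open import Data.Bool.Properties using (∧-identityʳ; ∧-zeroʳ)
  open import Data.Fin.Subset using (Subset; inside; outside)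
  open import Data.List using (List; []; _∷_; _++_; map; foldr; concatMap; length; filterᵇ)
  open import Data.List.Properties using (map-++; map-cong; map-∘)
  open import Data.Nat using (ℕ; zero; suc; _+_; _*_; _∸_; _⊔_; _⊓_; _≤ᵇ_)
  open import Data.Nat.ListAction using (sum)
  open import Data.Nat.ListAction.Properties using (sum-++)
  open import Data.Nat.Properties using (+-identityʳ; ⊔-identityʳ; 0∸n≡0; +-commutativeSemigroup)
  open import Data.Nat.Tactic.RingSolver using (solve-∀)
  open import Data.Vec using ([]; _∷_)
  open import Function using (_∘_)
  open import Relation.Binary.PropositionalEquality
  open import Algebra.Properties.CommutativeSemigroup +-commutativeSemigroup
    using () renaming (interchange to +-interchange)

  private variable
    A B : Set

  sum-map-++ : (f : A → ℕ) (xs ys : List A) →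
    sum (map f (xs ++ ys)) ≡ sum (map f xs) + sum (map f ys)
  sum-map-++ f xs ys = trans (cong sum (map-++ f xs ys)) (sum-++ (map f xs) (map f ys))

  sum-map-concatMap : (f : B → ℕ) (g : A → List B) (xs : List A) →
    sum (map f (concatMap g xs)) ≡ sum (map (λ x → sum (map f (g x))) xs)
  sum-map-concatMap f g []       = refl
  sum-map-concatMap f g (x ∷ xs) =
    trans (sum-map-++ f (g x) (concatMap g xs)) (cong (sum (map f (g x)) +_) (sum-map-concatMap f g xs))

  sum-map-+ : (f g : A → ℕ) (xs : List A) →
    sum (map (λ x → f x + g x) xs) ≡ sum (map f xs) + sum (map g xs)
  sum-map-+ f g []       = refl
  sum-map-+ f g (x ∷ xs) = trans (cong (f x + g x +_) (sum-map-+ f g xs)) (+-interchange (f x) (g x) _ _)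

  sum-map-zero : (xs : List A) → sum (map (λ _ → 0) xs) ≡ 0
  sum-map-zero []       = refl
  sum-map-zero (x ∷ xs) = sum-map-zero xs

  length-filterᵇ : (p : A → Bool) (xs : List A) →
    length (filterᵇ p xs) ≡ sum (map (λ x → if p x then 1 else 0) xs)
  length-filterᵇ p []       = refl
  length-filterᵇ p (x ∷ xs) with p x
  ... | true  = cong suc (length-filterᵇ p xs)
  ... | false = length-filterᵇ p xs

  nonemptyᵇ-outside : ∀ {n} (p : Subset n) → nonemptyᵇ (outside ∷ p) ≡ nonemptyᵇ p
  nonemptyᵇ-outside p with elems p
  ... | []    = refl
  ... | _ ∷ _ = refl

  foldr-⊓-map-suc : ∀ d xs → foldr _⊓_ (suc d) (map suc xs) ≡ suc (foldr _⊓_ d xs)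
  foldr-⊓-map-suc d []       = refl
  foldr-⊓-map-suc d (x ∷ xs) = cong (suc x ⊓_) (foldr-⊓-map-suc d xs)

  minS-outside : ∀ {n} (p : Subset n) → minS (outside ∷ p) ≡ suc (minS p)
  minS-outside {n} p = foldr-⊓-map-suc (suc n) (elems p)

  minS-inside : ∀ {n} (p : Subset n) → minS (inside ∷ p) ≡ 1
  minS-inside {n} p = cong (1 ⊓_) (foldr-⊓-map-suc (suc n) (elems p))

  suc-⊔-foldr-map-suc : ∀ a xs → suc a ⊔ foldr _⊔_ 0 (map suc xs) ≡ suc (a ⊔ foldr _⊔_ 0 xs)
  suc-⊔-foldr-map-suc a []       = cong suc (sym (⊔-identityʳ a))
  suc-⊔-foldr-map-suc a (x ∷ xs) = cong (suc a ⊔_) (suc-⊔-foldr-map-suc x xs)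

  maxS-inside : ∀ {n} (p : Subset n) → maxS (inside ∷ p) ≡ suc (maxS p)
  maxS-inside p = suc-⊔-foldr-map-suc 0 (elems p)

  maxS-outside : ∀ {n} (p : Subset n) → nonemptyᵇ p ≡ true → maxS (outside ∷ p) ≡ suc (maxS p)
  maxS-outside p ne with elems p
  ... | x ∷ xs = suc-⊔-foldr-map-suc x xs

  maxS-empty : ∀ {n} (p : Subset n) → nonemptyᵇ p ≡ false → maxS p ≡ 0
  maxS-empty p e with elems p
  ... | [] = refl

  validRowFrom : ∀ {n} → ℕ → List (Subset n) → Bool
  validRowFrom b []      = true
  validRowFrom b (x ∷ r) = (b ≤ᵇ minS x) ∧ nonemptyᵇ x ∧ validRowFrom (maxS x) r

  nonempty∧rowWeak≡validRowFrom : ∀ {n} (x : Subset n) r →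
    and (map nonemptyᵇ (x ∷ r)) ∧ rowWeak (x ∷ r) ≡ nonemptyᵇ x ∧ validRowFrom (maxS x) r
  nonempty∧rowWeak≡validRowFrom x []      = ∧-identityʳ (nonemptyᵇ x ∧ true)
  nonempty∧rowWeak≡validRowFrom x (y ∷ r) =
    trans (shuffle (nonemptyᵇ x) (maxS x ≤ᵇ minS y) _ _)
          (cong (λ v → nonemptyᵇ x ∧ (maxS x ≤ᵇ minS y) ∧ v) (nonempty∧rowWeak≡validRowFrom y r))
    where
    shuffle : ∀ a c p w → (a ∧ p) ∧ (c ∧ w) ≡ a ∧ c ∧ p ∧ w
    shuffle false c     p w = refl
    shuffle true  true  p w = refl
    shuffle true  false p w = ∧-zeroʳ p

  isSVT-oneRow : ∀ {n} (r : List (Subset n)) → isSVT (r ∷ []) ≡ validRowFrom 0 r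
  isSVT-oneRow r = begin
    (and (map nonemptyᵇ r) ∧ true) ∧ (rowWeak r ∧ true) ∧ true
      ≡⟨ cong₂ _∧_ (∧-identityʳ (and (map nonemptyᵇ r))) (∧-identityʳ (rowWeak r ∧ true)) ⟩
    and (map nonemptyᵇ r) ∧ rowWeak r ∧ true
      ≡⟨ cong (and (map nonemptyᵇ r) ∧_) (∧-identityʳ (rowWeak r)) ⟩
    and (map nonemptyᵇ r) ∧ rowWeak r
      ≡⟨ fromZero r ⟩
    validRowFrom 0 r ∎
    where
    open ≡-Reasoning
    fromZero : ∀ r → and (map nonemptyᵇ r) ∧ rowWeak r ≡ validRowFrom 0 r
    fromZero []      = refl
    fromZero (x ∷ r) = nonempty∧rowWeak≡validRowFrom x r

  countRowsFrom : ℕ → ℕ → ℕ → ℕ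
  countRowsFrom n k b = sum (map (λ r → if validRowFrom b r then 1 else 0) (listsOfLength (allSubsets n) k))

  numSVT-oneRow≡countRowsFrom : ∀ n k → numSVT (k ∷ []) n ≡ countRowsFrom n k 0
  numSVT-oneRow≡countRowsFrom n k = begin
    length (filterᵇ isSVT (fillings (k ∷ []) n))
      ≡⟨ length-filterᵇ isSVT (fillings (k ∷ []) n) ⟩
    sum (map indicator (concatMap (λ r → (r ∷ []) ∷ []) rows))
      ≡⟨ sum-map-concatMap indicator (λ r → (r ∷ []) ∷ []) rows ⟩
    sum (map (λ r → indicator (r ∷ []) + 0) rows)
      ≡⟨ cong sum (map-cong (λ r → trans (+-identityʳ _) (cong (λ v → if v then 1 else 0) (isSVT-oneRow r)))
                            rows) ⟩
    countRowsFrom n k 0 ∎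
    where
    open ≡-Reasoning
    rows : List (List (Subset n))
    rows = listsOfLength (allSubsets n) k
    indicator : List (List (Subset n)) → ℕ
    indicator t = if isSVT t then 1 else 0

  boxTerm : ∀ {n} → ℕ → (ℕ → ℕ) → Subset n → ℕ
  boxTerm b g x = if (b ≤ᵇ minS x) ∧ nonemptyᵇ x then g (maxS x) else 0

  boxSum : ℕ → ℕ → (ℕ → ℕ) → ℕ
  boxSum n b g = sum (map (boxTerm b g) (allSubsets n))

  countRowsFrom-suc : ∀ n k b → countRowsFrom n (suc k) b ≡ boxSum n b (countRowsFrom n k)
  countRowsFrom-suc n k b =
    trans (sum-map-concatMap _ _ (allSubsets n)) (cong sum (map-cong firstBox (allSubsets n)))
    where
    rows : List (List (Subset n))
    rows = listsOfLength (allSubsets n) k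
    withFirstBox : ∀ x →
      sum (map (λ r → if (b ≤ᵇ minS x) ∧ nonemptyᵇ x ∧ validRowFrom (maxS x) r then 1 else 0) rows)
        ≡ boxTerm b (countRowsFrom n k) x
    withFirstBox x with b ≤ᵇ minS x | nonemptyᵇ x
    ... | true  | true  = refl
    ... | true  | false = sum-map-zero rows
    ... | false | _     = sum-map-zero rows
    firstBox : ∀ x → sum (map (λ r → if validRowFrom b r then 1 else 0) (map (x ∷_) rows))
                   ≡ boxTerm b (countRowsFrom n k) x
    firstBox x = trans (cong sum (sym (map-∘ rows))) (withFirstBox x)

  ≤ᵇ-suc : ∀ b m → (b ≤ᵇ suc m) ≡ (b ∸ 1 ≤ᵇ m)
  ≤ᵇ-suc zero    m = refl
  ≤ᵇ-suc 1       m = refl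
  ≤ᵇ-suc (suc (suc b)) m = refl

  boxTerm-outside : ∀ {n} b g (p : Subset n) → boxTerm b g (outside ∷ p) ≡ boxTerm (b ∸ 1) (g ∘ suc) p
  boxTerm-outside b g p rewrite minS-outside p | nonemptyᵇ-outside p | ≤ᵇ-suc b (minS p)
    with nonemptyᵇ p in ne
  ... | true  = cong (λ m → if (b ∸ 1 ≤ᵇ minS p) ∧ true then g m else 0) (maxS-outside p ne)
  ... | false rewrite ∧-zeroʳ (b ∸ 1 ≤ᵇ minS p) = refl

  boxTerm-inside : ∀ {n} b g (p : Subset n) →
    boxTerm b g (inside ∷ p) ≡ (if b ≤ᵇ 1 then g (suc (maxS p)) else 0)
  boxTerm-inside b g p = cong₂ (λ c m → if c then g m else 0)
    (trans (cong (λ m → (b ≤ᵇ m) ∧ true) (minS-inside p)) (∧-identityʳ (b ≤ᵇ 1)))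
    (maxS-inside p)

  allSubsets-uniqueEmpty : ∀ n c → sum (map (λ p → if nonemptyᵇ p then 0 else c) (allSubsets n)) ≡ c
  allSubsets-uniqueEmpty zero    c = +-identityʳ c
  allSubsets-uniqueEmpty (suc n) c = begin
    sum (map isEmpty (allSubsets (suc n)))
      ≡⟨ sum-map-concatMap isEmpty _ (allSubsets n) ⟩
    sum (map (λ p → isEmpty (outside ∷ p) + (isEmpty (inside ∷ p) + 0)) (allSubsets n))
      ≡⟨ cong sum (map-cong (λ p → trans (+-identityʳ _) (cong (λ v → if v then 0 else c) (nonemptyᵇ-outside p)))
                            (allSubsets n)) ⟩
    sum (map isEmpty (allSubsets n))
      ≡⟨ allSubsets-uniqueEmpty n c ⟩
    c ∎
    where
    open ≡-Reasoning
    isEmpty : ∀ {m} → Subset m → ℕ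
    isEmpty p = if nonemptyᵇ p then 0 else c

  sum-map-maxS : ∀ n h → sum (map (h ∘ maxS) (allSubsets n)) ≡ h 0 + boxSum n 0 h
  sum-map-maxS n h = begin
    sum (map (h ∘ maxS) (allSubsets n))
      ≡⟨ cong sum (map-cong emptyOrNot (allSubsets n)) ⟩
    sum (map (λ p → (if nonemptyᵇ p then 0 else h 0) + boxTerm 0 h p) (allSubsets n))
      ≡⟨ sum-map-+ _ _ (allSubsets n) ⟩
    sum (map (λ p → if nonemptyᵇ p then 0 else h 0) (allSubsets n)) + boxSum n 0 h
      ≡⟨ cong (_+ boxSum n 0 h) (allSubsets-uniqueEmpty n (h 0)) ⟩
    h 0 + boxSum n 0 h ∎
    where
    open ≡-Reasoning
    emptyOrNot : ∀ p → h (maxS p) ≡ (if nonemptyᵇ p then 0 else h 0) + boxTerm 0 h p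
    emptyOrNot p with nonemptyᵇ p in ne
    ... | true  = refl
    ... | false = trans (cong h (maxS-empty p ne)) (sym (+-identityʳ (h 0)))

  boxSum-suc : ∀ n b g →
    boxSum (suc n) b g ≡ boxSum n (b ∸ 1) (g ∘ suc) + (if b ≤ᵇ 1 then g 1 + boxSum n 0 (g ∘ suc) else 0)
  boxSum-suc n b g = begin
    sum (map (boxTerm b g) (allSubsets (suc n)))
      ≡⟨ sum-map-concatMap (boxTerm b g) _ (allSubsets n) ⟩
    sum (map (λ p → boxTerm b g (outside ∷ p) + (boxTerm b g (inside ∷ p) + 0)) (allSubsets n))
      ≡⟨ cong sum (map-cong outsideOrInside (allSubsets n)) ⟩
    sum (map (λ p → boxTerm (b ∸ 1) (g ∘ suc) p + withOne p) (allSubsets n))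
      ≡⟨ sum-map-+ _ withOne (allSubsets n) ⟩
    boxSum n (b ∸ 1) (g ∘ suc) + sum (map withOne (allSubsets n))
      ≡⟨ cong (boxSum n (b ∸ 1) (g ∘ suc) +_) sumWithOne ⟩
    boxSum n (b ∸ 1) (g ∘ suc) + (if b ≤ᵇ 1 then g 1 + boxSum n 0 (g ∘ suc) else 0) ∎
    where
    open ≡-Reasoning
    withOne : Subset n → ℕ
    withOne p = if b ≤ᵇ 1 then g (suc (maxS p)) else 0
    outsideOrInside : ∀ p → boxTerm b g (outside ∷ p) + (boxTerm b g (inside ∷ p) + 0)
                          ≡ boxTerm (b ∸ 1) (g ∘ suc) p + withOne p
    outsideOrInside p = cong₂ _+_ (boxTerm-outside b g p) (trans (+-identityʳ _) (boxTerm-inside b g p))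
    sumWithOne : sum (map withOne (allSubsets n)) ≡ (if b ≤ᵇ 1 then g 1 + boxSum n 0 (g ∘ suc) else 0)
    sumWithOne with b ≤ᵇ 1
    ... | true  = sum-map-maxS n (g ∘ suc)
    ... | false = sum-map-zero (allSubsets n)

  boxSum-zero : ∀ b g → boxSum 0 b g ≡ 0
  boxSum-zero b g = cong (λ c → (if c then g 0 else 0) + 0) (∧-zeroʳ (b ≤ᵇ 1))

  boxSum-cong⁺ : ∀ n b (f g : ℕ → ℕ) → (∀ j → f (suc j) ≡ g (suc j)) →
    boxSum n b f ≡ boxSum n b g
  boxSum-cong⁺ zero    b f g eq = trans (boxSum-zero b f) (sym (boxSum-zero b g))
  boxSum-cong⁺ (suc n) b f g eq = begin
    boxSum (suc n) b f
      ≡⟨ boxSum-suc n b f ⟩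
    boxSum n (b ∸ 1) (f ∘ suc) + (if b ≤ᵇ 1 then f 1 + boxSum n 0 (f ∘ suc) else 0)
      ≡⟨ cong₂ (λ u v → u + (if b ≤ᵇ 1 then v else 0))
               (boxSum-cong⁺ n (b ∸ 1) (f ∘ suc) (g ∘ suc) (eq ∘ suc))
               (cong₂ _+_ (eq 0) (boxSum-cong⁺ n 0 (f ∘ suc) (g ∘ suc) (eq ∘ suc))) ⟩
    boxSum n (b ∸ 1) (g ∘ suc) + (if b ≤ᵇ 1 then g 1 + boxSum n 0 (g ∘ suc) else 0)
      ≡⟨ boxSum-suc n b g ⟨
    boxSum (suc n) b g ∎
    where open ≡-Reasoning

  -- Rows avoiding 1 live on {2,…,n+1}; otherwise the first box is either {1}, followed by a row with
  -- k boxes on [n+1], or {1} ∪ S with S the first box of a row on {2,…,n+1}.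
  rowCount : ℕ → ℕ → ℕ
  rowCount n       zero    = 1
  rowCount zero    (suc k) = 0
  rowCount (suc n) (suc k) = rowCount (suc n) k + 2 * rowCount n (suc k)

  boxSum-rowCount : ∀ k n b →
    boxSum n b (λ j → rowCount (n ∸ (j ∸ 1)) k) ≡ rowCount (n ∸ (b ∸ 1)) (suc k)
  boxSum-rowCount k zero    b rewrite 0∸n≡0 (b ∸ 1) = boxSum-zero b (λ j → rowCount (0 ∸ (j ∸ 1)) k)
  boxSum-rowCount k (suc n) b = trans (boxSum-suc n b g) (split b)
    where
    g h : ℕ → ℕ
    g j = rowCount (suc n ∸ (j ∸ 1)) k
    h j = rowCount (n ∸ (j ∸ 1)) k
    withoutOne : boxSum n 0 (g ∘ suc) ≡ rowCount n (suc k)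
    withoutOne = trans (boxSum-cong⁺ n 0 (g ∘ suc) h (λ j → refl)) (boxSum-rowCount k n 0)
    withOne : boxSum n 0 (g ∘ suc) + (g 1 + boxSum n 0 (g ∘ suc)) ≡ rowCount (suc n) (suc k)
    withOne rewrite withoutOne = x+[y+x]≡y+2x (rowCount n (suc k)) (rowCount (suc n) k)
      where
      x+[y+x]≡y+2x : ∀ x y → x + (y + x) ≡ y + 2 * x
      x+[y+x]≡y+2x = solve-∀
    split : ∀ b → boxSum n (b ∸ 1) (g ∘ suc) + (if b ≤ᵇ 1 then g 1 + boxSum n 0 (g ∘ suc) else 0)
                ≡ rowCount (suc n ∸ (b ∸ 1)) (suc k)
    split 0             = withOne
    split 1             = withOne
    split (suc (suc b)) =
      trans (+-identityʳ _) (trans (boxSum-cong⁺ n (suc b) (g ∘ suc) h (λ j → refl)) (boxSum-rowCount k n (suc b)))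

  -- Rows on [n] whose entries are all ≥ b are rows on the n ∸ (b ∸ 1) numbers max(b,1), …, n.
  countRowsFrom≡rowCount : ∀ n k b → countRowsFrom n k b ≡ rowCount (n ∸ (b ∸ 1)) k
  countRowsFrom≡rowCount n zero    b = refl
  countRowsFrom≡rowCount n (suc k) b = begin
    countRowsFrom n (suc k) b                      ≡⟨ countRowsFrom-suc n k b ⟩
    boxSum n b (countRowsFrom n k)                 ≡⟨ boxSum-cong⁺ n b (countRowsFrom n k) (λ j → rowCount (n ∸ (j ∸ 1)) k)
                                                                   (countRowsFrom≡rowCount n k ∘ suc) ⟩
    boxSum n b (λ j → rowCount (n ∸ (j ∸ 1)) k)     ≡⟨ boxSum-rowCount k n b ⟩
    rowCount (n ∸ (b ∸ 1)) (suc k)                 ∎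
    where open ≡-Reasoning

  numSVT-oneRow≡rowCount : ∀ n k → numSVT (k ∷ []) n ≡ rowCount n k
  numSVT-oneRow≡rowCount n k = trans (numSVT-oneRow≡countRowsFrom n k) (countRowsFrom≡rowCount n k 0)

module BinomialSums where
  open OneRowTableaux using (rowCount)
  open import Data.List using ([]; _∷_; _++_; applyUpTo)
  open import Data.List.Properties using (applyUpTo-∷ʳ)
  open import Data.Nat using (ℕ; zero; suc; _+_; _*_; _∸_; _<_; z≤n; s≤s; _!; NonZero)
  open import Data.Nat.Combinatorics using (_C_; nCk+nC[k+1]≡[n+1]C[k+1]; k![n∸k]!∣n!)
  open import Data.Nat.Combinatorics.Specification using (nCk≡n!/k![n-k]!; k>n⇒nCk≡0)
  open import Data.Nat.DivMod using (m/n*n≡m)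
  open import Data.Nat.ListAction using (sum)
  open import Data.Nat.ListAction.Properties using (sum-++)
  open import Data.Nat.Properties
  open import Data.Nat.Tactic.RingSolver using (solve-∀)
  open import Data.Product using (_,_)
  open import Function using (_∘_)
  open import Relation.Binary.PropositionalEquality
  open import Relation.Nullary using (yes; no)

  private variable
    A : Set

  applyUpTo-cong< : ∀ n {f g : ℕ → A} → (∀ i → i < n → f i ≡ g i) → applyUpTo f n ≡ applyUpTo g n
  applyUpTo-cong< zero    eq = refl
  applyUpTo-cong< (suc n) eq =
    cong₂ _∷_ (eq 0 (s≤s z≤n)) (applyUpTo-cong< n (λ i i<n → eq (suc i) (s≤s i<n)))

  ∑< : ℕ → (ℕ → ℕ) → ℕ
  ∑< n f = sum (applyUpTo f n)

  syntax ∑< n (λ i → e) = ∑[ i < n ] e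

  ∑<-cong : ∀ n {f g : ℕ → ℕ} → (∀ i → f i ≡ g i) → ∑< n f ≡ ∑< n g
  ∑<-cong n eq = cong sum (applyUpTo-cong< n (λ i _ → eq i))

  ∑<-zero : ∀ n {f : ℕ → ℕ} → (∀ i → i < n → f i ≡ 0) → ∑< n f ≡ 0
  ∑<-zero zero    eq = refl
  ∑<-zero (suc n) eq = cong₂ _+_ (eq 0 (s≤s z≤n)) (∑<-zero n (λ i i<n → eq (suc i) (s≤s i<n)))

  ∑<-+ : ∀ n (f g : ℕ → ℕ) → ∑[ i < n ] (f i + g i) ≡ ∑< n f + ∑< n g
  ∑<-+ zero    f g = refl
  ∑<-+ (suc n) f g = trans (cong (f 0 + g 0 +_) (∑<-+ n (f ∘ suc) (g ∘ suc))) (interchange (f 0) (g 0) _ _)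
    where
    interchange : ∀ a b c d → (a + b) + (c + d) ≡ (a + c) + (b + d)
    interchange = solve-∀

  ∑<-suc : ∀ n (f : ℕ → ℕ) → ∑< (suc n) f ≡ ∑< n f + f n
  ∑<-suc n f = begin
    sum (applyUpTo f (suc n))        ≡⟨ cong sum (applyUpTo-∷ʳ f n) ⟨
    sum (applyUpTo f n ++ f n ∷ [])  ≡⟨ sum-++ (applyUpTo f n) (f n ∷ []) ⟩
    ∑< n f + (f n + 0)               ≡⟨ cong (∑< n f +_) (+-identityʳ (f n)) ⟩
    ∑< n f + f n                     ∎
    where open ≡-Reasoning

  ∑<-split : ∀ a b (f : ℕ → ℕ) → ∑< (a + b) f ≡ ∑< a f + ∑[ m < b ] f (a + m)
  ∑<-split zero    b f = refl
  ∑<-split (suc a) b f = trans (cong (f 0 +_) (∑<-split a b (f ∘ suc))) (sym (+-assoc (f 0) _ _))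

  binomialSum : ℕ → ℕ → ℕ
  binomialSum M k = ∑[ i < M ] ((M C suc i) * (i C k))

  binomialSum-suc : ∀ M k → binomialSum (suc M) k ≡ ∑[ i < suc M ] ((M C i) * (i C k)) + binomialSum M k
  binomialSum-suc M k = begin
    ∑[ i < suc M ] ((suc M C suc i) * (i C k))
      ≡⟨ ∑<-cong (suc M) (λ i → cong (_* (i C k)) (sym (nCk+nC[k+1]≡[n+1]C[k+1] M i))) ⟩
    ∑[ i < suc M ] (((M C i) + (M C suc i)) * (i C k))
      ≡⟨ ∑<-cong (suc M) (λ i → *-distribʳ-+ (i C k) (M C i) (M C suc i)) ⟩
    ∑[ i < suc M ] ((M C i) * (i C k) + (M C suc i) * (i C k))
      ≡⟨ ∑<-+ (suc M) (λ i → (M C i) * (i C k)) (λ i → (M C suc i) * (i C k)) ⟩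
    S + ∑[ i < suc M ] ((M C suc i) * (i C k))
      ≡⟨ cong (S +_) (∑<-suc M (λ i → (M C suc i) * (i C k))) ⟩
    S + (binomialSum M k + (M C suc M) * (M C k))
      ≡⟨ cong (λ c → S + (binomialSum M k + c * (M C k))) (k>n⇒nCk≡0 (n<1+n M)) ⟩
    S + (binomialSum M k + 0)
      ≡⟨ cong (S +_) (+-identityʳ (binomialSum M k)) ⟩
    S + binomialSum M k ∎
    where
    open ≡-Reasoning
    S : ℕ
    S = ∑[ i < suc M ] ((M C i) * (i C k))

  ∑<-*iCk≡0 : ∀ k (f : ℕ → ℕ) → ∑[ i < k ] (f i * (i C k)) ≡ 0
  ∑<-*iCk≡0 k f = ∑<-zero k (λ i i<k → trans (cong (f i *_) (k>n⇒nCk≡0 i<k)) (*-zeroʳ (f i)))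

  rowCount≡binomialSum : ∀ n k → rowCount n (suc k) ≡ binomialSum (n + k) k
  rowCount≡binomialSum zero    k       = sym (∑<-*iCk≡0 k (λ i → k C suc i))
  rowCount≡binomialSum (suc n) zero    = begin
    1 + 2 * rowCount n 1
      ≡⟨ cong (λ x → 1 + 2 * x) (rowCount≡binomialSum n 0) ⟩
    1 + 2 * binomialSum (n + 0) 0
      ≡⟨ 1+2x≡[1+x]+x (binomialSum (n + 0) 0) ⟩
    (1 + binomialSum (n + 0) 0) + binomialSum (n + 0) 0
      ≡⟨ binomialSum-suc (n + 0) 0 ⟨
    binomialSum (suc n + 0) 0 ∎
    where
    open ≡-Reasoning
    1+2x≡[1+x]+x : ∀ x → 1 + 2 * x ≡ (1 + x) + x
    1+2x≡[1+x]+x = solve-∀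
  rowCount≡binomialSum (suc n) (suc k) = begin
    rowCount (suc n) (suc k) + 2 * rowCount n (suc (suc k))
      ≡⟨ cong₂ (λ x y → x + 2 * y)
               (trans (rowCount≡binomialSum (suc n) k) (cong (λ M → binomialSum M k) (sym (+-suc n k))))
               (rowCount≡binomialSum n (suc k)) ⟩
    binomialSum M k + 2 * binomialSum M (suc k)
      ≡⟨ x+2y≡[x+y]+y (binomialSum M k) (binomialSum M (suc k)) ⟩
    (binomialSum M k + binomialSum M (suc k)) + binomialSum M (suc k)
      ≡⟨ cong (_+ binomialSum M (suc k))
              (∑<-+ M (λ i → (M C suc i) * (i C k)) (λ i → (M C suc i) * (i C suc k))) ⟨
    ∑[ i < M ] ((M C suc i) * (i C k) + (M C suc i) * (i C suc k)) + binomialSum M (suc k)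
      ≡⟨ cong (_+ binomialSum M (suc k))
              (∑<-cong M (λ i → *-distribˡ-+ (M C suc i) (i C k) (i C suc k))) ⟨
    ∑[ i < M ] ((M C suc i) * ((i C k) + (i C suc k))) + binomialSum M (suc k)
      ≡⟨ cong (_+ binomialSum M (suc k))
              (∑<-cong M (λ i → cong ((M C suc i) *_) (nCk+nC[k+1]≡[n+1]C[k+1] i k))) ⟩
    ∑[ i < M ] ((M C suc i) * (suc i C suc k)) + binomialSum M (suc k)
      ≡⟨ binomialSum-suc M (suc k) ⟨
    binomialSum (suc M) (suc k) ∎
    where
    open ≡-Reasoning
    M : ℕ
    M = n + suc k
    x+2y≡[x+y]+y : ∀ x y → x + 2 * y ≡ (x + y) + y
    x+2y≡[x+y]+y = solve-∀

  binomialSum-tail : ∀ k n → binomialSum (k + n) k ≡ ∑[ m < n ] (((k + n) C suc (k + m)) * ((k + m) C k))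
  binomialSum-tail k n = begin
    binomialSum (k + n) k
      ≡⟨ ∑<-split k n (λ i → ((k + n) C suc i) * (i C k)) ⟩
    ∑[ i < k ] (((k + n) C suc i) * (i C k)) + ∑[ m < n ] (((k + n) C suc (k + m)) * ((k + m) C k))
      ≡⟨ cong (_+ ∑[ m < n ] (((k + n) C suc (k + m)) * ((k + m) C k)))
              (∑<-*iCk≡0 k (λ i → (k + n) C suc i)) ⟩
    ∑[ m < n ] (((k + n) C suc (k + m)) * ((k + m) C k)) ∎
    where open ≡-Reasoning

  [k+d]Ck*[k!*d!]≡[k+d]! : ∀ k d → ((k + d) C k) * (k ! * d !) ≡ (k + d) !
  [k+d]Ck*[k!*d!]≡[k+d]! k d =
    subst (λ e → ((k + d) C k) * (k ! * e !) ≡ (k + d) !) (m+n∸m≡n k d) nCk*k![n∸k]!≡n!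
    where
    instance _ = k !* (k + d ∸ k) !≢0
    nCk*k![n∸k]!≡n! : ((k + d) C k) * (k ! * (k + d ∸ k) !) ≡ (k + d) !
    nCk*k![n∸k]!≡n! = trans (cong (_* (k ! * (k + d ∸ k) !)) (nCk≡n!/k![n-k]! (m≤m+n k d)))
                            (m/n*n≡m (k![n∸k]!∣n! (m≤m+n k d)))

  absorption : ∀ k d → suc (k + d) * ((k + d) C k) ≡ suc k * (suc (k + d) C suc k)
  absorption k d = *-cancelʳ-≡ _ _ (k ! * d !) {{k !* d !≢0}} (begin
    suc (k + d) * ((k + d) C k) * (k ! * d !)       ≡⟨ *-assoc (suc (k + d)) ((k + d) C k) (k ! * d !) ⟩
    suc (k + d) * (((k + d) C k) * (k ! * d !))     ≡⟨ cong (suc (k + d) *_) ([k+d]Ck*[k!*d!]≡[k+d]! k d) ⟩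
    (suc k + d) !                                   ≡⟨ [k+d]Ck*[k!*d!]≡[k+d]! (suc k) d ⟨
    ((suc k + d) C suc k) * ((suc k * k !) * d !)   ≡⟨ regroup ((suc k + d) C suc k) (suc k) (k !) (d !) ⟩
    suc k * ((suc k + d) C suc k) * (k ! * d !)     ∎)
    where
    open ≡-Reasoning
    regroup : ∀ c s f g → c * ((s * f) * g) ≡ s * c * (f * g)
    regroup = solve-∀

  [n∸k]*nCk≡[1+k]*nC[1+k] : ∀ n k → (n ∸ k) * (n C k) ≡ suc k * (n C suc k)
  [n∸k]*nCk≡[1+k]*nC[1+k] n k with k <? n
  ... | no k≮n = begin
    (n ∸ k) * (n C k)    ≡⟨ cong (_* (n C k)) (m≤n⇒m∸n≡0 (≮⇒≥ k≮n)) ⟩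
    0                    ≡⟨ *-zeroʳ (suc k) ⟨
    suc k * 0            ≡⟨ cong (suc k *_) (k>n⇒nCk≡0 (s≤s (≮⇒≥ k≮n))) ⟨
    suc k * (n C suc k)  ∎
    where open ≡-Reasoning
  ... | yes k<n with m≤n⇒∃[o]m+o≡n k<n
  ...   | d , refl = *-cancelʳ-≡ _ _ (k ! * d !) {{k !* d !≢0}} (begin
    (suc k + d ∸ k) * ((suc k + d) C k) * (k ! * d !)
      ≡⟨ cong (λ e → e * ((suc k + d) C k) * (k ! * d !)) [1+k+d]∸k≡1+d ⟩
    suc d * ((suc k + d) C k) * (k ! * d !)
      ≡⟨ regroup ((suc k + d) C k) (suc d) (k !) (d !) ⟩
    ((suc k + d) C k) * (k ! * (suc d) !)
      ≡⟨ cong (λ e → (e C k) * (k ! * (suc d) !)) (+-suc k d) ⟨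
    ((k + suc d) C k) * (k ! * (suc d) !)
      ≡⟨ [k+d]Ck*[k!*d!]≡[k+d]! k (suc d) ⟩
    (k + suc d) !
      ≡⟨ cong _! (+-suc k d) ⟩
    (suc k + d) !
      ≡⟨ [k+d]Ck*[k!*d!]≡[k+d]! (suc k) d ⟨
    ((suc k + d) C suc k) * ((suc k * k !) * d !)
      ≡⟨ regroup′ ((suc k + d) C suc k) (suc k) (k !) (d !) ⟩
    suc k * ((suc k + d) C suc k) * (k ! * d !) ∎)
    where
    open ≡-Reasoning
    [1+k+d]∸k≡1+d : suc k + d ∸ k ≡ suc d
    [1+k+d]∸k≡1+d = trans (cong (_∸ k) (sym (+-suc k d))) (m+n∸m≡n k (suc d))
    regroup : ∀ c s f g → s * c * (f * g) ≡ c * (f * (s * g))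
    regroup = solve-∀
    regroup′ : ∀ c s f g → c * ((s * f) * g) ≡ s * c * (f * g)
    regroup′ = solve-∀

  trinomial-revision : ∀ k n m → ((k + n) C k) * (n C m) ≡ ((k + n) C (k + m)) * ((k + m) C k)
  trinomial-revision k n m with m ≤? n
  ... | no m≰n = begin
    ((k + n) C k) * (n C m)                    ≡⟨ cong (((k + n) C k) *_) (k>n⇒nCk≡0 (≰⇒> m≰n)) ⟩
    ((k + n) C k) * 0                          ≡⟨ *-zeroʳ ((k + n) C k) ⟩
    0                                          ≡⟨ cong (_* ((k + m) C k)) (k>n⇒nCk≡0 (+-monoʳ-< k (≰⇒> m≰n))) ⟨
    ((k + n) C (k + m)) * ((k + m) C k)        ∎
    where open ≡-Reasoning
  ... | yes m≤n with m≤n⇒∃[o]m+o≡n m≤n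
  ...   | e , refl = *-cancelʳ-≡ _ _ (k ! * m ! * e !) {{m*n≢0 _ _ {{k !* m !≢0}} {{e !≢0}}}} (begin
    ((k + (m + e)) C k) * ((m + e) C m) * (k ! * m ! * e !)
      ≡⟨ regroup ((k + (m + e)) C k) ((m + e) C m) (k !) (m !) (e !) ⟩
    ((k + (m + e)) C k) * (k ! * (((m + e) C m) * (m ! * e !)))
      ≡⟨ cong (λ x → ((k + (m + e)) C k) * (k ! * x)) ([k+d]Ck*[k!*d!]≡[k+d]! m e) ⟩
    ((k + (m + e)) C k) * (k ! * (m + e) !)
      ≡⟨ [k+d]Ck*[k!*d!]≡[k+d]! k (m + e) ⟩
    (k + (m + e)) !
      ≡⟨ cong _! (+-assoc k m e) ⟨
    (k + m + e) !
      ≡⟨ [k+d]Ck*[k!*d!]≡[k+d]! (k + m) e ⟨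
    ((k + m + e) C (k + m)) * ((k + m) ! * e !)
      ≡⟨ cong (λ x → ((k + m + e) C (k + m)) * (x * e !)) ([k+d]Ck*[k!*d!]≡[k+d]! k m) ⟨
    ((k + m + e) C (k + m)) * (((k + m) C k) * (k ! * m !) * e !)
      ≡⟨ cong (λ t → (t C (k + m)) * (((k + m) C k) * (k ! * m !) * e !)) (+-assoc k m e) ⟩
    ((k + (m + e)) C (k + m)) * (((k + m) C k) * (k ! * m !) * e !)
      ≡⟨ regroup′ ((k + (m + e)) C (k + m)) ((k + m) C k) (k ! * m !) (e !) ⟩
    ((k + (m + e)) C (k + m)) * ((k + m) C k) * (k ! * m ! * e !) ∎)
    where
    open ≡-Reasoning
    regroup : ∀ a b x y z → a * b * (x * y * z) ≡ a * (x * (b * (y * z)))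
    regroup = solve-∀
    regroup′ : ∀ a b x z → a * (b * x * z) ≡ a * b * (x * z)
    regroup′ = solve-∀

  rising : ℕ → ℕ → ℕ
  rising a zero    = 1
  rising a (suc m) = rising a m * (a + m)

  rising-nonZero : ∀ a m → NonZero (rising (suc a) m)
  rising-nonZero a zero    = _
  rising-nonZero a (suc m) = m*n≢0 (rising (suc a) m) (suc a + m) {{rising-nonZero a m}}

  rising-shift : ∀ a m → rising a m * (a + m) ≡ a * rising (suc a) m
  rising-shift a zero    = trans (*-identityˡ (a + 0)) (trans (+-identityʳ a) (sym (*-identityʳ a)))
  rising-shift a (suc m) = begin
    rising a m * (a + m) * (a + suc m)    ≡⟨ cong (_* (a + suc m)) (rising-shift a m) ⟩
    a * rising (suc a) m * (a + suc m)    ≡⟨ cong (a * rising (suc a) m *_) (+-suc a m) ⟩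
    a * rising (suc a) m * (suc a + m)    ≡⟨ *-assoc a (rising (suc a) m) (suc a + m) ⟩
    a * rising (suc a) (suc m)            ∎
    where open ≡-Reasoning

  binomialTerm : ℕ → ℕ → ℕ → ℕ
  binomialTerm k n m = ((suc k + n) C (suc k + m)) * ((k + m) C k)

  rowCount≡∑binomialTerm : ∀ n k → rowCount (suc n) (suc k) ≡ ∑[ m < suc n ] binomialTerm k n m
  rowCount≡∑binomialTerm n k = begin
    rowCount (suc n) (suc k)
      ≡⟨ rowCount≡binomialSum (suc n) k ⟩
    binomialSum (suc n + k) k
      ≡⟨ cong (λ M → binomialSum M k) (+-comm (suc n) k) ⟩
    binomialSum (k + suc n) k
      ≡⟨ binomialSum-tail k (suc n) ⟩
    ∑[ m < suc n ] (((k + suc n) C suc (k + m)) * ((k + m) C k))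
      ≡⟨ cong (λ M → ∑[ m < suc n ] ((M C suc (k + m)) * ((k + m) C k))) (+-suc k n) ⟩
    ∑[ m < suc n ] binomialTerm k n m ∎
    where open ≡-Reasoning

  -- The m-th Gauss term times C(k+1+n, k+1), with its denominator (k+2)_m m! cleared.
  binomialTerm-cleared : ∀ k n m →
    ((suc k + n) C suc k) * (rising (suc k) m * (m ! * (n C m)))
      ≡ binomialTerm k n m * (rising (suc (suc k)) m * m !)
  binomialTerm-cleared k n m = *-cancelʳ-≡ _ _ (suc k + m) (begin
    X * (r₁ * (m ! * Y)) * (suc k + m)      ≡⟨ regroup X r₁ (m !) Y (suc k + m) ⟩
    X * Y * m ! * (r₁ * (suc k + m))        ≡⟨ cong₂ (λ p q → p * m ! * q) (trinomial-revision (suc k) n m)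
                                                                          (rising-shift (suc k) m) ⟩
    Z * V * m ! * (suc k * r₂)              ≡⟨ regroup′ Z V (m !) (suc k) r₂ ⟩
    Z * (suc k * V) * (r₂ * m !)            ≡⟨ cong (λ p → Z * p * (r₂ * m !)) (absorption k m) ⟨
    Z * (suc (k + m) * W) * (r₂ * m !)      ≡⟨ regroup″ Z (suc (k + m)) W (r₂ * m !) ⟩
    Z * W * (r₂ * m !) * (suc k + m)        ∎)
    where
    open ≡-Reasoning
    X Y Z V W r₁ r₂ : ℕ
    X = (suc k + n) C suc k
    Y = n C m
    Z = (suc k + n) C (suc k + m)
    V = (suc k + m) C suc k
    W = (k + m) C k
    r₁ = rising (suc k) m
    r₂ = rising (suc (suc k)) m
    regroup : ∀ x r f y s → x * (r * (f * y)) * s ≡ x * y * f * (r * s)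
    regroup = solve-∀
    regroup′ : ∀ z v f a r → z * v * f * (a * r) ≡ z * (a * v) * (r * f)
    regroup′ = solve-∀
    regroup″ : ∀ z s w q → z * (s * w) * q ≡ z * w * q * s
    regroup″ = solve-∀

module GaussSeries where
  open BinomialSums
  open import Data.Integer as ℤ using ()
  import Data.Integer.Properties as ℤ
  open import Data.List using (applyUpTo)
  open import Data.Nat as ℕ using (ℕ; zero; suc; _∸_; _≤_; _!)
  import Data.Nat.Properties as ℕ
  open import Data.Nat.Coprimality as Coprime using (1-coprimeTo)
  open import Data.Nat.Combinatorics using (_C_)
  open import Data.Product using (_,_)
  open import Data.Rational as ℚ using (ℚ; mkℚ; 0ℚ; 1ℚ; _+_; _*_; _-_; -_; 1/_; _≟_)
  open import Data.Rational.Properties as ℚ using ()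
  open import Data.Rational.Solver using (module +-*-Solver)
  open import Function using (_∘_)
  open import Relation.Binary.PropositionalEquality
  open import Relation.Nullary using (yes; no; contradiction)
  open +-*-Solver

  natℚ≡mkℚ : ∀ a → natℚ a ≡ mkℚ (ℤ.+ a) 0 (Coprime.sym (1-coprimeTo a))
  natℚ≡mkℚ a = ℚ.↥p/↧p≡p (mkℚ (ℤ.+ a) 0 (Coprime.sym (1-coprimeTo a)))

  natℚ-+ : ∀ a b → natℚ (a ℕ.+ b) ≡ natℚ a + natℚ b
  natℚ-+ a b = sym (begin
    natℚ a + natℚ b
      ≡⟨ cong₂ _+_ (natℚ≡mkℚ a) (natℚ≡mkℚ b) ⟩
    (ℤ.+ a ℤ.* ℤ.+ 1 ℤ.+ ℤ.+ b ℤ.* ℤ.+ 1) ℚ./ 1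
      ≡⟨ cong₂ (λ x y → (x ℤ.+ y) ℚ./ 1) (ℤ.*-identityʳ (ℤ.+ a)) (ℤ.*-identityʳ (ℤ.+ b)) ⟩
    natℚ (a ℕ.+ b) ∎)
    where open ≡-Reasoning

  natℚ-* : ∀ a b → natℚ (a ℕ.* b) ≡ natℚ a * natℚ b
  natℚ-* a b = sym (begin
    natℚ a * natℚ b             ≡⟨ cong₂ _*_ (natℚ≡mkℚ a) (natℚ≡mkℚ b) ⟩
    (ℤ.+ a ℤ.* ℤ.+ b) ℚ./ 1         ≡⟨ cong (ℚ._/ 1) (ℤ.pos-* a b) ⟨
    natℚ (a ℕ.* b)              ∎)
    where open ≡-Reasoning

  natℚ-nonZero : ∀ d → .{{ℕ.NonZero d}} → natℚ d ≢ 0ℚ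
  natℚ-nonZero (suc d) eq with () ← cong ℚ.numerator (trans (sym (natℚ≡mkℚ (suc d))) eq)

  /ℚ-*-cancel : ∀ p {q} → q ≢ 0ℚ → (p /ℚ q) * q ≡ p
  /ℚ-*-cancel p {q} q≢0 with q ≟ 0ℚ
  ... | yes q≡0 = contradiction q≡0 q≢0
  ... | no _    = begin
    p * 1/ q * q     ≡⟨ ℚ.*-assoc p (1/ q) q ⟩
    p * (1/ q * q)   ≡⟨ cong (p *_) (ℚ.*-inverseˡ q) ⟩
    p * 1ℚ           ≡⟨ ℚ.*-identityʳ p ⟩
    p                ∎
    where
    open ≡-Reasoning
    instance _ = ℚ.≢-nonZero q≢0

  *-cancelʳ : ∀ {p q} r → r ≢ 0ℚ → p * r ≡ q * r → p ≡ q
  *-cancelʳ {p} {q} r r≢0 eq = begin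
    p                  ≡⟨ cancel p ⟨
    p * r * 1/ r       ≡⟨ cong (_* 1/ r) eq ⟩
    q * r * 1/ r       ≡⟨ cancel q ⟩
    q                  ∎
    where
    open ≡-Reasoning
    instance _ = ℚ.≢-nonZero r≢0
    cancel : ∀ p → p * r * 1/ r ≡ p
    cancel p = trans (ℚ.*-assoc p r (1/ r)) (trans (cong (p *_) (ℚ.*-inverseʳ r)) (ℚ.*-identityʳ p))

  poch-natℚ : ∀ a m → poch (natℚ a) m ≡ natℚ (rising a m)
  poch-natℚ a zero    = refl
  poch-natℚ a (suc m) = begin
    poch (natℚ a) m * (natℚ a + natℚ m)     ≡⟨ cong₂ _*_ (poch-natℚ a m) (sym (natℚ-+ a m)) ⟩
    natℚ (rising a m) * natℚ (a ℕ.+ m)      ≡⟨ natℚ-* (rising a m) (a ℕ.+ m) ⟨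
    natℚ (rising a (suc m))                 ∎
    where open ≡-Reasoning

  [1-[1+n]+m]*-1≡n∸m : ∀ n m → m ≤ n → (1ℚ - natℚ (suc n) + natℚ m) * (- 1ℚ) ≡ natℚ (n ∸ m)
  [1-[1+n]+m]*-1≡n∸m n m m≤n with ℕ.m≤n⇒∃[o]m+o≡n m≤n
  ... | d , refl = begin
    (1ℚ - natℚ (suc (m ℕ.+ d)) + natℚ m) * (- 1ℚ)         ≡⟨ cong (λ x → (1ℚ - x + natℚ m) * (- 1ℚ)) 1+m+d ⟩
    (1ℚ - (1ℚ + (natℚ m + natℚ d)) + natℚ m) * (- 1ℚ)     ≡⟨ linear (natℚ m) (natℚ d) ⟩
    natℚ d                                                ≡⟨ cong natℚ (ℕ.m+n∸m≡n m d) ⟨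
    natℚ (m ℕ.+ d ∸ m)                                    ∎
    where
    open ≡-Reasoning
    1+m+d : natℚ (suc (m ℕ.+ d)) ≡ 1ℚ + (natℚ m + natℚ d)
    1+m+d = trans (natℚ-+ 1 (m ℕ.+ d)) (cong (1ℚ +_) (natℚ-+ m d))
    linear : ∀ x y → (1ℚ - (1ℚ + (x + y)) + x) * (- 1ℚ) ≡ y
    linear = solve 2 (λ x y → (con 1ℚ :- (con 1ℚ :+ (x :+ y)) :+ x) :* (:- con 1ℚ) := y) refl

  poch-negative : ∀ n m → m ≤ n → poch (1ℚ - natℚ (suc n)) m * ((- 1ℚ) ^ℚ m) ≡ natℚ (m ! ℕ.* (n C m))
  poch-negative n zero    _   = refl
  poch-negative n (suc m) m<n = begin
    poch b m * (b + natℚ m) * ((- 1ℚ) ^ℚ m * (- 1ℚ))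
      ≡⟨ regroup (poch b m) (b + natℚ m) ((- 1ℚ) ^ℚ m) (- 1ℚ) ⟩
    poch b m * (- 1ℚ) ^ℚ m * ((b + natℚ m) * (- 1ℚ))
      ≡⟨ cong₂ _*_ (poch-negative n m (ℕ.<⇒≤ m<n)) ([1-[1+n]+m]*-1≡n∸m n m (ℕ.<⇒≤ m<n)) ⟩
    natℚ (m ! ℕ.* (n C m)) * natℚ (n ∸ m)
      ≡⟨ natℚ-* (m ! ℕ.* (n C m)) (n ∸ m) ⟨
    natℚ (m ! ℕ.* (n C m) ℕ.* (n ∸ m))
      ≡⟨ cong natℚ falling ⟩
    natℚ (suc m ! ℕ.* (n C suc m))   ∎
    where
    open ≡-Reasoning
    b = 1ℚ - natℚ (suc n)
    regroup : ∀ p x s y → p * x * (s * y) ≡ p * s * (x * y)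
    regroup = solve 4 (λ p x s y → p :* x :* (s :* y) := p :* s :* (x :* y)) refl
    falling : m ! ℕ.* (n C m) ℕ.* (n ∸ m) ≡ suc m ! ℕ.* (n C suc m)
    falling = begin
      m ! ℕ.* (n C m) ℕ.* (n ∸ m)     ≡⟨ ℕ.*-assoc (m !) (n C m) (n ∸ m) ⟩
      m ! ℕ.* ((n C m) ℕ.* (n ∸ m))   ≡⟨ cong (m ! ℕ.*_) (ℕ.*-comm (n C m) (n ∸ m)) ⟩
      m ! ℕ.* ((n ∸ m) ℕ.* (n C m))   ≡⟨ cong (m ! ℕ.*_) ([n∸k]*nCk≡[1+k]*nC[1+k] n m) ⟩
      m ! ℕ.* (suc m ℕ.* (n C suc m)) ≡⟨ ℕ.*-assoc (m !) (suc m) (n C suc m) ⟨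
      m ! ℕ.* suc m ℕ.* (n C suc m)   ≡⟨ cong (ℕ._* (n C suc m)) (ℕ.*-comm (m !) (suc m)) ⟩
      suc m ! ℕ.* (n C suc m)         ∎

  gaussTerm : ℚ → ℚ → ℚ → ℚ → ℕ → ℚ
  gaussTerm a b c z m = ((poch a m * poch b m) /ℚ poch c m) * ((z ^ℚ m) /ℚ natℚ (m !))

  hypergeometricTerm : ∀ k n m → m ≤ n →
    natℚ ((suc k ℕ.+ n) C suc k) * gaussTerm (natℚ (suc k)) (1ℚ - natℚ (suc n)) (natℚ (suc (suc k))) (- 1ℚ) m
      ≡ natℚ (binomialTerm k n m)
  hypergeometricTerm k n m m≤n = *-cancelʳ (natℚ (r₂ ℕ.* m !)) (natℚ-nonZero (r₂ ℕ.* m !) {{r₂*m!≢0}}) (begin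
    x * ((poch (natℚ (suc k)) m * P) /ℚ poch (natℚ (suc (suc k))) m * (S /ℚ f)) * natℚ (r₂ ℕ.* m !)
      ≡⟨ cong₂ (λ u v → x * ((u * P) /ℚ v * (S /ℚ f)) * natℚ (r₂ ℕ.* m !))
               (poch-natℚ (suc k) m) (poch-natℚ (suc (suc k)) m) ⟩
    x * ((y * P) /ℚ q * (S /ℚ f)) * natℚ (r₂ ℕ.* m !)
      ≡⟨ cong (x * ((y * P) /ℚ q * (S /ℚ f)) *_) (natℚ-* r₂ (m !)) ⟩
    x * ((y * P) /ℚ q * (S /ℚ f)) * (q * f)
      ≡⟨ regroup x ((y * P) /ℚ q) (S /ℚ f) q f ⟩
    x * ((y * P) /ℚ q * q) * (S /ℚ f * f)
      ≡⟨ cong₂ (λ u v → x * u * v) (/ℚ-*-cancel (y * P) (natℚ-nonZero r₂ {{r₂≢0}}))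
                                   (/ℚ-*-cancel S (natℚ-nonZero (m !) {{ℕ._!≢0 m}})) ⟩
    x * (y * P) * S
      ≡⟨ regroup′ x y P S ⟩
    x * (y * (P * S))
      ≡⟨ cong (λ u → x * (y * u)) (poch-negative n m m≤n) ⟩
    x * (y * natℚ (m ! ℕ.* (n C m)))
      ≡⟨ trans (natℚ-* X _) (cong (x *_) (natℚ-* r₁ _)) ⟨
    natℚ (X ℕ.* (r₁ ℕ.* (m ! ℕ.* (n C m))))
      ≡⟨ cong natℚ (binomialTerm-cleared k n m) ⟩
    natℚ (binomialTerm k n m ℕ.* (r₂ ℕ.* m !))
      ≡⟨ natℚ-* (binomialTerm k n m) (r₂ ℕ.* m !) ⟩
    natℚ (binomialTerm k n m) * natℚ (r₂ ℕ.* m !) ∎)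
    where
    open ≡-Reasoning
    X r₁ r₂ : ℕ
    X = (suc k ℕ.+ n) C suc k
    r₁ = rising (suc k) m
    r₂ = rising (suc (suc k)) m
    x y q f P S : ℚ
    x = natℚ X
    y = natℚ r₁
    q = natℚ r₂
    f = natℚ (m !)
    P = poch (1ℚ - natℚ (suc n)) m
    S = (- 1ℚ) ^ℚ m
    r₂≢0 : ℕ.NonZero r₂
    r₂≢0 = rising-nonZero (suc k) m
    r₂*m!≢0 : ℕ.NonZero (r₂ ℕ.* m !)
    r₂*m!≢0 = ℕ.m*n≢0 r₂ (m !) {{r₂≢0}} {{ℕ._!≢0 m}}
    regroup : ∀ x u v p q → x * (u * v) * (p * q) ≡ x * (u * p) * (v * q)
    regroup = solve 5 (λ x u v p q → x :* (u :* v) :* (p :* q) := x :* (u :* p) :* (v :* q)) refl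
    regroup′ : ∀ x r p s → x * (r * p) * s ≡ x * (r * (p * s))
    regroup′ = solve 4 (λ x r p s → x :* (r :* p) :* s := x :* (r :* (p :* s))) refl

  natℚ-∑< : ∀ n f → natℚ (∑< n f) ≡ sumℚ (applyUpTo (natℚ ∘ f) n)
  natℚ-∑< zero    f = refl
  natℚ-∑< (suc n) f = trans (natℚ-+ (f 0) (∑< n (f ∘ suc))) (cong (natℚ (f 0) +_) (natℚ-∑< n (f ∘ suc)))

  *-distribˡ-sumℚ : ∀ c n (f : ℕ → ℚ) → c * sumℚ (applyUpTo f n) ≡ sumℚ (applyUpTo (λ m → c * f m) n)
  *-distribˡ-sumℚ c zero    f = ℚ.*-zeroʳ c
  *-distribˡ-sumℚ c (suc n) f =
    trans (ℚ.*-distribˡ-+ c (f 0) _) (cong (c * f 0 +_) (*-distribˡ-sumℚ c n (f ∘ suc)))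

open import Data.Nat using (ℕ; suc; _≥_; _∸_; _+_)
open import Data.Nat.Combinatorics using (_C_)
open import Data.List using (_∷_; []; applyUpTo)
open import Data.Rational using (ℚ; _*_; _-_; 1ℚ; -_)
open import Relation.Binary.PropositionalEquality using (_≡_; sym; cong; module ≡-Reasoning)
open import Data.Nat.Properties using (+-comm; ≤-pred)
open import Function using (_∘_)
open OneRowTableaux using (rowCount; numSVT-oneRow≡rowCount)
open BinomialSums using (∑<; applyUpTo-cong<; binomialTerm; rowCount≡∑binomialTerm)
open GaussSeries

corollary3p3 : (n k : ℕ) → n ≥ 1 → k ≥ 1 →
    natℚ (numSVT (k ∷ []) n)
      ≡ natℚ ((n + k ∸ 1) C k)
        * F21 (natℚ k) (1ℚ - natℚ n) (natℚ (suc k)) (- 1ℚ) (n ∸ 1)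
corollary3p3 (suc n) (suc k) _ _ = begin
  natℚ (numSVT (suc k ∷ []) (suc n))
    ≡⟨ cong natℚ (numSVT-oneRow≡rowCount (suc n) (suc k)) ⟩
  natℚ (rowCount (suc n) (suc k))
    ≡⟨ cong natℚ (rowCount≡∑binomialTerm n k) ⟩
  natℚ (∑[ m < suc n ] binomialTerm k n m)
    ≡⟨ natℚ-∑< (suc n) (binomialTerm k n) ⟩
  sumℚ (applyUpTo (natℚ ∘ binomialTerm k n) (suc n))
    ≡⟨ cong sumℚ (applyUpTo-cong< (suc n) (λ m m<1+n → sym (hypergeometricTerm k n m (≤-pred m<1+n)))) ⟩
  sumℚ (applyUpTo (λ m → natℚ ((suc k + n) C suc k) * gaussTerm a b c (- 1ℚ) m) (suc n))
    ≡⟨ *-distribˡ-sumℚ (natℚ ((suc k + n) C suc k)) (suc n) (gaussTerm a b c (- 1ℚ)) ⟨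
  natℚ ((suc k + n) C suc k) * F21 a b c (- 1ℚ) n
    ≡⟨ cong (λ N → natℚ (N C suc k) * F21 a b c (- 1ℚ) n) (+-comm (suc k) n) ⟩
  natℚ ((n + suc k) C suc k) * F21 a b c (- 1ℚ) n ∎
  where
  open ≡-Reasoning
  a b c : ℚ
  a = natℚ (suc k)
  b = 1ℚ - natℚ (suc n)
  c = natℚ (suc (suc k))
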